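{- The varieties $\mathcal{CHA}$ (connexive Heyting algebras) and $\mathcal{HA}$ (Heyting algebras) are term equivalent. More precisely: for every $\mathbf A=\langle A,\wedge,\vee,\rightarrow,0,1\rangle\in\mathcal{CHA}$, setting $a\Rightarrow b:=a\rightarrow(a\wedge b)$, the algebra $\mathbb{H}(\mathbf A)=\langle A,\wedge,\vee,\Rightarrow,0,1\rangle$ is a Heyting algebra; for every Heyting algebra $\mathbf B=\langle B,\wedge,\vee,\Rightarrow,0,1\rangle$, setting $a\rightarrow b:=(a\Rightarrow b)\wedge(\neg a\Rightarrow\neg b)$ (with $\neg a:=a\Rightarrow 0$), the algebra $\mathbb{C}(\mathbf B)=\langle B,\wedge,\vee,\rightarrow,0,1\rangle$ is a connexive Heyting algebra; and the maps $\mathbb H$ and $\mathbb C$ are mutually inverse, i.e. $\mathbb{C}(\mathbb{H}(\mathbf A))=\mathbf A$ for every $\mathbf A\in\mathcal{CHA}$ and $\mathbb{H}(\mathbb{C}(\mathbf B))=\mathbf B$ for every $\mathbf B\in\mathcal{HA}$.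
   Context: A connexive Heyting algebra is an algebra $\mathbf A=\langle A,\wedge,\vee,\rightarrow,0,1\rangle$ of type $\langle 2,2,2,0,0\rangle$ such that $\langle A,\wedge,\vee,0,1\rangle$ is a bounded distributive lattice with bottom $0$, top $1$ and lattice order $\le$, and, writing $\neg x:=x\rightarrow 0$, the following hold for all elements: (C1) $(x\rightarrow y)\rightarrow((y\rightarrow z)\rightarrow(x\rightarrow z))=1$; (C2) $(x\rightarrow y)\rightarrow\neg(x\rightarrow\neg y)=1$; (C3) $x\wedge(x\rightarrow y)=x\wedge y$; (C4) $x\rightarrow y\le(z\wedge x)\rightarrow(z\wedge y)$; (C5) $x\rightarrow y\le(z\vee x)\rightarrow(z\vee y)$. $\mathcal{CHA}$ denotes the variety of connexive Heyting algebras and $\mathcal{HA}$ the variety of Heyting algebras $\langle B,\wedge,\vee,\Rightarrow,0,1\rangle$, where $\Rightarrow$ is relative pseudocomplementation. -}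

module Defs where

open import Level using (Level)
open import Data.Product using (_×_)
open import Function.Bundles using (_⇔_)
open import Relation.Binary.PropositionalEquality using (_≡_)
open import Algebra.Core using (Op₂)
import Algebra.Lattice.Structures as LS

private variable
  a : Level

record IsBDL {A : Set a} (_∧_ _∨_ : Op₂ A) (𝟎 𝟏 : A) : Set a where
  field
    isDistributiveLattice : LS.IsDistributiveLattice _≡_ _∨_ _∧_
    ∨-identityʳ : ∀ x → (x ∨ 𝟎) ≡ x
    ∧-identityʳ : ∀ x → (x ∧ 𝟏) ≡ x

_≤[_]_ : {A : Set a} → A → Op₂ A → A → Set a
x ≤[ _∧_ ] y = (x ∧ y) ≡ x

record IsCHA {A : Set a} (_∧_ _∨_ _↝_ : Op₂ A) (𝟎 𝟏 : A) : Set a where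
  ¬_ : A → A
  ¬ x = x ↝ 𝟎
  field
    isBDL : IsBDL _∧_ _∨_ 𝟎 𝟏
    C1 : ∀ x y z → ((x ↝ y) ↝ ((y ↝ z) ↝ (x ↝ z))) ≡ 𝟏
    C2 : ∀ x y → ((x ↝ y) ↝ (¬ (x ↝ (¬ y)))) ≡ 𝟏
    C3 : ∀ x y → (x ∧ (x ↝ y)) ≡ (x ∧ y)
    C4 : ∀ x y z → (x ↝ y) ≤[ _∧_ ] ((z ∧ x) ↝ (z ∧ y))
    C5 : ∀ x y z → (x ↝ y) ≤[ _∧_ ] ((z ∨ x) ↝ (z ∨ y))

record IsHA {A : Set a} (_∧_ _∨_ _⇒_ : Op₂ A) (𝟎 𝟏 : A) : Set a where
  field
    isBDL : IsBDL _∧_ _∨_ 𝟎 𝟏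
    relPseudoCompl : ∀ x y z → (z ≤[ _∧_ ] (x ⇒ y)) ⇔ ((z ∧ x) ≤[ _∧_ ] y)

H⇒ : {A : Set a} → Op₂ A → Op₂ A → Op₂ A
H⇒ _∧_ _↝_ x y = x ↝ (x ∧ y)

C↝ : {A : Set a} → Op₂ A → A → Op₂ A → Op₂ A
C↝ _∧_ 𝟎 _⇒_ x y = (x ⇒ y) ∧ ((x ⇒ 𝟎) ⇒ (y ⇒ 𝟎))

-- In a Heyting algebra, x ↝ y := (x ⇒ y) ∧ (¬ x ⇒ ¬ y) pairs an implication with its
-- contraposition; (C1)–(C5) then follow by natural deduction, and every inequality with
-- right-hand side 𝟎 may be checked by a truth table on literals, since ¬ ¬ (x ∨ ¬ x) = 𝟏.
-- Conversely, in a connexive Heyting algebra (C3) is modus ponens for ↝ and (C4)/(C5) make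
-- x ↝ (x ∧ _) monotone, which gives residuation for x ⇒ y := x ↝ (x ∧ y).  To recover ↝,
-- (C4) and (C2) give x ↝ y ≤ x ⇒ y and x ↝ y ≤ ¬ x ⇒ ¬ y; back, ¬ x ⇒ ¬ y ≤ ¬ ¬ (y ⇒ x),
-- and ¬ ¬ c ≤ c ↝ 𝟏 (an instance of (C1)) turns this into (x ∧ y) ↝ y, which (C1)
-- composes with x ⇒ y = x ↝ (x ∧ y).
module Submission where

open import Defs
open import Level using (Level)
open import Data.Product using (_×_; _,_)
open import Function.Bundles using (mk⇔; Equivalence)
open import Relation.Binary.PropositionalEquality
open import Algebra.Core using (Op₂)
open import Algebra.Lattice.Bundles using (Lattice)
import Algebra.Lattice.Properties.Lattice as LatticeProperties
import Algebra.Lattice.Structures as LS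
import Relation.Binary.Lattice as R
import Relation.Binary.Lattice.Properties.BoundedLattice as BoundedLatticeProperties
import Relation.Binary.Lattice.Properties.HeytingAlgebra as HeytingAlgebraProperties
import Relation.Binary.Lattice.Properties.JoinSemilattice as JoinSemilatticeProperties

module BoundedLatticeOrder {a : Level} {A : Set a} {_∧_ _∨_ : Op₂ A} {𝟎 𝟏 : A}
                           (isBDL : IsBDL _∧_ _∨_ 𝟎 𝟏) where
  -- _≤_ is the library's natural order x ≡ x ∧ y, the mirror image of x ≤[ _∧_ ] y.
  open IsBDL isBDL public using (∧-identityʳ)
  open IsBDL isBDL using (isDistributiveLattice; ∨-identityʳ)
  open LS.IsDistributiveLattice isDistributiveLattice public
    using (∧-comm; ∧-assoc; ∨-comm; ∧-distribˡ-∨)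

  lattice : Lattice a a
  lattice = record { isLattice = LS.IsDistributiveLattice.isLattice isDistributiveLattice }

  open LatticeProperties lattice public using (∧-idem)
  open LatticeProperties lattice using (∨-∧-isOrderTheoreticLattice; ∨-∧-orderTheoreticLattice)
  open R.Lattice ∨-∧-orderTheoreticLattice using (y≤x∨y)

  boundedLattice : R.BoundedLattice a a a
  boundedLattice = record
    { isBoundedLattice = record
      { isLattice = ∨-∧-isOrderTheoreticLattice
      ; maximum   = λ x → sym (∧-identityʳ x)
      ; minimum   = λ x → subst (𝟎 ≤_) (∨-identityʳ x) (y≤x∨y x 𝟎)
      }
    }
    where open R.Lattice ∨-∧-orderTheoreticLattice using (_≤_)

  open R.BoundedLattice boundedLattice public
    using (_≤_; reflexive; x∧y≤x; x∧y≤y; ∧-greatest; x≤x∨y; y≤x∨y; ∨-least; maximum; minimum)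
    renaming (refl to ≤-refl; trans to ≤-trans; antisym to ≤-antisym)
  open BoundedLatticeProperties boundedLattice public using (∧-zeroʳ)
  open JoinSemilatticeProperties (R.BoundedLattice.joinSemilattice boundedLattice) public
    using (x≤y⇒x∨y≈y)

  ∧-identityˡ : ∀ x → 𝟏 ∧ x ≡ x
  ∧-identityˡ x = trans (∧-comm 𝟏 x) (∧-identityʳ x)

module HeytingSequents {a : Level} {A : Set a} {_∧_ _∨_ _⇒_ : Op₂ A} {𝟎 𝟏 : A}
                       (isHA : IsHA _∧_ _∨_ _⇒_ 𝟎 𝟏) where
  open IsHA isHA
  open BoundedLatticeOrder isBDL public

  heytingAlgebra : R.HeytingAlgebra a a a
  heytingAlgebra = record
    { isHeytingAlgebra = record
      { isBoundedLattice = R.BoundedLattice.isBoundedLattice boundedLattice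
      ; exponential      = λ w x y →
          (λ p → sym (Equivalence.from (relPseudoCompl x y w) (sym p))) ,
          (λ p → sym (Equivalence.to (relPseudoCompl x y w) (sym p)))
      }
    }

  open HeytingAlgebraProperties heytingAlgebra using (de-morgan₁)
  open R.HeytingAlgebra heytingAlgebra using (transpose-⇨; transpose-∧)

  infix 30 ¬_
  ¬_ : A → A
  ¬ x = x ⇒ 𝟎

  private variable
    Γ Δ x y z : A

  -- Γ ≤ x is the sequent Γ ⊢ x.  Introduction rules bind hypotheses in every Δ ≤ Γ,
  -- so an outer hypothesis h is used there as wk ρ h.
  wk : Δ ≤ Γ → Γ ≤ x → Δ ≤ x
  wk = ≤-trans

  ∧-elimˡ : Γ ≤ x ∧ y → Γ ≤ x
  ∧-elimˡ h = ≤-trans h (x∧y≤x _ _)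

  ∧-elimʳ : Γ ≤ x ∧ y → Γ ≤ y
  ∧-elimʳ h = ≤-trans h (x∧y≤y _ _)

  ∨-introˡ : Γ ≤ x → Γ ≤ x ∨ y
  ∨-introˡ h = ≤-trans h (x≤x∨y _ _)

  ∨-introʳ : Γ ≤ y → Γ ≤ x ∨ y
  ∨-introʳ h = ≤-trans h (y≤x∨y _ _)

  ⇒-intro : (∀ {Δ} → Δ ≤ Γ → Δ ≤ x → Δ ≤ y) → Γ ≤ x ⇒ y
  ⇒-intro k = transpose-⇨ (k (x∧y≤x _ _) (x∧y≤y _ _))

  ⇒-elim : Γ ≤ x ⇒ y → Γ ≤ x → Γ ≤ y
  ⇒-elim f h = ≤-trans (∧-greatest ≤-refl h) (transpose-∧ f)

  ⊥-elim : Γ ≤ 𝟎 → Γ ≤ x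
  ⊥-elim h = ≤-trans h (minimum _)

  ¬-intro : (∀ {Δ} → Δ ≤ Γ → Δ ≤ x → Δ ≤ 𝟎) → Γ ≤ ¬ x
  ¬-intro = ⇒-intro

  ¬-elim : Γ ≤ ¬ x → Γ ≤ x → Γ ≤ 𝟎
  ¬-elim = ⇒-elim

  ¬¬-intro : Γ ≤ x → Γ ≤ ¬ ¬ x
  ¬¬-intro h = ¬-intro λ ρ n → ¬-elim n (wk ρ h)

  refute : x ∧ y ≤ 𝟎 → Γ ≤ x → Γ ≤ ¬ y
  refute clash h = ¬-intro λ ρ h′ → ≤-trans (∧-greatest (wk ρ h) h′) clash

  ∨-elim : Γ ≤ x ∨ y → (∀ {Δ} → Δ ≤ Γ → Δ ≤ x → Δ ≤ z) → (∀ {Δ} → Δ ≤ Γ → Δ ≤ y → Δ ≤ z)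
         → Γ ≤ z
  ∨-elim {Γ} {x} {y} h kx ky = ≤-trans (∧-greatest ≤-refl h)
    (≤-trans (reflexive (∧-distribˡ-∨ Γ x y))
             (∨-least (kx (x∧y≤x _ _) (x∧y≤y _ _)) (ky (x∧y≤x _ _) (x∧y≤y _ _))))

  ¬∨-elimˡ : Γ ≤ ¬ (x ∨ y) → Γ ≤ ¬ x
  ¬∨-elimˡ {x = x} {y} h = ∧-elimˡ (≤-trans h (reflexive (de-morgan₁ x y)))

  ¬∨-elimʳ : Γ ≤ ¬ (x ∨ y) → Γ ≤ ¬ y
  ¬∨-elimʳ {x = x} {y} h = ∧-elimʳ (≤-trans h (reflexive (de-morgan₁ x y)))

  ¬∨-intro : Γ ≤ ¬ x → Γ ≤ ¬ y → Γ ≤ ¬ (x ∨ y)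
  ¬∨-intro {x = x} {y} h h′ = ≤-trans (∧-greatest h h′) (reflexive (sym (de-morgan₁ x y)))

  ¬∧-elim : Γ ≤ ¬ (x ∧ y) → Γ ≤ x → Γ ≤ ¬ y
  ¬∧-elim n hx = ¬-intro λ ρ hy → ¬-elim (wk ρ n) (∧-greatest (wk ρ hx) hy)

  data Literal (Γ x : A) : Set a where
    holds : Γ ≤ x → Literal Γ x
    fails : Γ ≤ ¬ x → Literal Γ x

  wk-Literal : Δ ≤ Γ → Literal Γ x → Literal Δ x
  wk-Literal ρ (holds h) = holds (wk ρ h)
  wk-Literal ρ (fails h) = fails (wk ρ h)

  -- Refutations may reason classically: both ¬ x and ¬ ¬ x lead to 𝟎.
  by-cases : ∀ x → (∀ {Δ} → Δ ≤ Γ → Literal Δ x → Δ ≤ 𝟎) → Γ ≤ 𝟎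
  by-cases x k = ¬-elim (¬-intro λ ρ n → k ρ (fails n)) (¬-intro λ ρ h → k ρ (holds h))

  by-cases₂ : ∀ x y → (∀ {Δ} → Δ ≤ Γ → Literal Δ x → Literal Δ y → Δ ≤ 𝟎) → Γ ≤ 𝟎
  by-cases₂ x y k =
    by-cases x λ ρ lx → by-cases y λ ρ′ ly → k (≤-trans ρ′ ρ) (wk-Literal ρ′ lx) ly

  by-cases₃ : ∀ x y z → (∀ {Δ} → Δ ≤ Γ → Literal Δ x → Literal Δ y → Literal Δ z → Δ ≤ 𝟎)
            → Γ ≤ 𝟎
  by-cases₃ x y z k = by-cases₂ x y λ ρ lx ly → by-cases z λ ρ′ lz →
    k (≤-trans ρ′ ρ) (wk-Literal ρ′ lx) (wk-Literal ρ′ ly) lz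

  ¬⇒¬≤¬¬⇒ : ∀ x y → (¬ x ⇒ ¬ y) ≤ ¬ ¬ (y ⇒ x)
  ¬⇒¬≤¬¬⇒ x y = refute (by-cases₂ x y λ ρ → table (∧-elimˡ ρ) (∧-elimʳ ρ)) ≤-refl
    where
    table : Γ ≤ ¬ x ⇒ ¬ y → Γ ≤ ¬ (y ⇒ x) → Literal Γ x → Literal Γ y → Γ ≤ 𝟎
    table _ n (holds hx) _          = ¬-elim n (⇒-intro λ ρ _ → wk ρ hx)
    table _ n _          (fails ny) = ¬-elim n (⇒-intro λ ρ hy → ⊥-elim (¬-elim (wk ρ ny) hy))
    table c _ (fails nx) (holds hy) = ¬-elim (⇒-elim c nx) hy

module HeytingToConnexive {a : Level} {A : Set a} {_∧_ _∨_ _⇒_ : Op₂ A} {𝟎 𝟏 : A}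
                          (isHA : IsHA _∧_ _∨_ _⇒_ 𝟎 𝟏) where
  open IsHA isHA using (isBDL)
  open HeytingSequents isHA

  infixr 5 _↝_
  _↝_ : Op₂ A
  _↝_ = C↝ _∧_ 𝟎 _⇒_

  private variable
    Γ x y z : A

  ↝-intro : (∀ {Δ} → Δ ≤ Γ → Δ ≤ x → Δ ≤ y) → (∀ {Δ} → Δ ≤ Γ → Δ ≤ ¬ x → Δ ≤ ¬ y) → Γ ≤ x ↝ y
  ↝-intro k k′ = ∧-greatest (⇒-intro k) (⇒-intro k′)

  ↝-elim : Γ ≤ x ↝ y → Γ ≤ x → Γ ≤ y
  ↝-elim h = ⇒-elim (∧-elimˡ h)

  ↝-contra : Γ ≤ x ↝ y → Γ ≤ ¬ x → Γ ≤ ¬ y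
  ↝-contra h = ⇒-elim (∧-elimʳ h)

  ↝-both : Γ ≤ x → Γ ≤ y → Γ ≤ x ↝ y
  ↝-both hx hy = ↝-intro (λ ρ _ → wk ρ hy) (λ ρ nx → ⊥-elim (¬-elim nx (wk ρ hx)))

  ↝-neither : Γ ≤ ¬ x → Γ ≤ ¬ y → Γ ≤ x ↝ y
  ↝-neither nx ny = ↝-intro (λ ρ hx → ⊥-elim (¬-elim (wk ρ nx) hx)) (λ ρ _ → wk ρ ny)

  ↝-clashˡ : Γ ≤ x ↝ y → Γ ≤ x → Γ ≤ ¬ y → Γ ≤ 𝟎
  ↝-clashˡ h hx ny = ¬-elim ny (↝-elim h hx)

  ↝-clashʳ : Γ ≤ x ↝ y → Γ ≤ ¬ x → Γ ≤ y → Γ ≤ 𝟎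
  ↝-clashʳ h nx hy = ¬-elim (↝-contra h nx) hy

  ¬↝ˡ : Γ ≤ x → Γ ≤ ¬ y → Γ ≤ ¬ (x ↝ y)
  ¬↝ˡ hx ny = ¬-intro λ ρ h → ↝-clashˡ h (wk ρ hx) (wk ρ ny)

  ¬↝ʳ : Γ ≤ ¬ x → Γ ≤ y → Γ ≤ ¬ (x ↝ y)
  ¬↝ʳ nx hy = ¬-intro λ ρ h → ↝-clashʳ h (wk ρ nx) (wk ρ hy)

  ↝-trans : Γ ≤ x ↝ y → Γ ≤ y ↝ z → Γ ≤ x ↝ z
  ↝-trans f g = ↝-intro (λ ρ hx → ↝-elim (wk ρ g) (↝-elim (wk ρ f) hx))
                        (λ ρ nx → ↝-contra (wk ρ g) (↝-contra (wk ρ f) nx))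

  ↝-valid : (∀ {Γ} → Γ ≤ x → Γ ≤ y) → (∀ {Γ} → Γ ≤ ¬ x → Γ ≤ ¬ y) → x ↝ y ≡ 𝟏
  ↝-valid k k′ = ≤-antisym (maximum _) (↝-intro (λ _ → k) (λ _ → k′))

  ↝𝟎≡¬ : ∀ x → x ↝ 𝟎 ≡ ¬ x
  ↝𝟎≡¬ x = ≤-antisym (∧-elimˡ ≤-refl) (↝-intro ¬-elim (λ _ _ → ¬-intro λ _ h → h))

  ↝-C1 : ∀ x y z → (x ↝ y) ↝ ((y ↝ z) ↝ (x ↝ z)) ≡ 𝟏
  ↝-C1 x y z = ↝-valid
    (λ p → ↝-intro (λ ρ r → ↝-trans (wk ρ p) r) (λ ρ nr → refute clash (∧-greatest (wk ρ p) nr)))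
    (refute clash′)
    where
    clash : ((x ↝ y) ∧ ¬ (y ↝ z)) ∧ (x ↝ z) ≤ 𝟎
    clash = by-cases x λ ρ → table (∧-elimˡ (∧-elimˡ ρ)) (∧-elimʳ (∧-elimˡ ρ)) (∧-elimʳ ρ)
      where
      table : Γ ≤ x ↝ y → Γ ≤ ¬ (y ↝ z) → Γ ≤ x ↝ z → Literal Γ x → Γ ≤ 𝟎
      table p nr s (holds hx) = ¬-elim nr (↝-both (↝-elim p hx) (↝-elim s hx))
      table p nr s (fails nx) = ¬-elim nr (↝-neither (↝-contra p nx) (↝-contra s nx))
    clash′ : ¬ (x ↝ y) ∧ ((y ↝ z) ↝ (x ↝ z)) ≤ 𝟎
    -- once x and y differ, so do y ↝ z and x ↝ z
    clash′ = by-cases₃ x y z λ ρ → table (∧-elimˡ ρ) (∧-elimʳ ρ)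
      where
      table : Γ ≤ ¬ (x ↝ y) → Γ ≤ (y ↝ z) ↝ (x ↝ z)
            → Literal Γ x → Literal Γ y → Literal Γ z → Γ ≤ 𝟎
      table np _ (holds hx) (holds hy) _          = ¬-elim np (↝-both hx hy)
      table np _ (fails nx) (fails ny) _          = ¬-elim np (↝-neither nx ny)
      table _  q (holds hx) (fails ny) (holds hz) = ↝-clashʳ q (¬↝ʳ ny hz) (↝-both hx hz)
      table _  q (holds hx) (fails ny) (fails nz) = ↝-clashˡ q (↝-neither ny nz) (¬↝ˡ hx nz)
      table _  q (fails nx) (holds hy) (holds hz) = ↝-clashˡ q (↝-both hy hz) (¬↝ʳ nx hz)
      table _  q (fails nx) (holds hy) (fails nz) = ↝-clashʳ q (¬↝ˡ hy nz) (↝-neither nx nz)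

  ↝-C2 : ∀ x y → (x ↝ y) ↝ ((x ↝ (y ↝ 𝟎)) ↝ 𝟎) ≡ 𝟏
  ↝-C2 x y = begin
    (x ↝ y) ↝ ((x ↝ (y ↝ 𝟎)) ↝ 𝟎) ≡⟨ cong (λ t → (x ↝ y) ↝ ((x ↝ t) ↝ 𝟎)) (↝𝟎≡¬ y) ⟩
    (x ↝ y) ↝ ((x ↝ ¬ y) ↝ 𝟎)     ≡⟨ cong ((x ↝ y) ↝_) (↝𝟎≡¬ (x ↝ ¬ y)) ⟩
    (x ↝ y) ↝ ¬ (x ↝ ¬ y)         ≡⟨ ↝-valid (refute incompatible) (refute exhaustive) ⟩
    𝟏                             ∎
    where
    open ≡-Reasoning
    incompatible : (x ↝ y) ∧ (x ↝ ¬ y) ≤ 𝟎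
    incompatible = by-cases x λ ρ → table (∧-elimˡ ρ) (∧-elimʳ ρ)
      where
      table : Γ ≤ x ↝ y → Γ ≤ x ↝ ¬ y → Literal Γ x → Γ ≤ 𝟎
      table p q (holds hx) = ¬-elim (↝-elim q hx) (↝-elim p hx)
      table p q (fails nx) = ¬-elim (↝-contra q nx) (↝-contra p nx)
    exhaustive : ¬ (x ↝ y) ∧ ¬ (x ↝ ¬ y) ≤ 𝟎
    exhaustive = by-cases₂ x y λ ρ → table (∧-elimˡ ρ) (∧-elimʳ ρ)
      where
      table : Γ ≤ ¬ (x ↝ y) → Γ ≤ ¬ (x ↝ ¬ y) → Literal Γ x → Literal Γ y → Γ ≤ 𝟎
      table n _  (holds hx) (holds hy) = ¬-elim n (↝-both hx hy)
      table _ n′ (holds hx) (fails ny) = ¬-elim n′ (↝-both hx ny)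
      table _ n′ (fails nx) (holds hy) = ¬-elim n′ (↝-neither nx (¬¬-intro hy))
      table n _  (fails nx) (fails ny) = ¬-elim n (↝-neither nx ny)

  ↝-C3 : ∀ x y → x ∧ (x ↝ y) ≡ x ∧ y
  ↝-C3 x y = ≤-antisym
    (∧-greatest (x∧y≤x _ _) (↝-elim (x∧y≤y _ _) (x∧y≤x _ _)))
    (∧-greatest (x∧y≤x _ _) (↝-both (x∧y≤x _ _) (x∧y≤y _ _)))

  ↝-C4 : ∀ x y z → x ↝ y ≤ (z ∧ x) ↝ (z ∧ y)
  ↝-C4 x y z = ↝-intro
    (λ ρ h → ∧-greatest (∧-elimˡ h) (↝-elim ρ (∧-elimʳ h)))
    (λ ρ n → ¬-intro λ ρ′ h → ↝-clashʳ (wk ρ′ ρ) (¬∧-elim (wk ρ′ n) (∧-elimˡ h)) (∧-elimʳ h))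

  ↝-C5 : ∀ x y z → x ↝ y ≤ (z ∨ x) ↝ (z ∨ y)
  ↝-C5 x y z = ↝-intro
    (λ ρ h → ∨-elim h (λ _ → ∨-introˡ) (λ ρ′ hx → ∨-introʳ (↝-elim (wk ρ′ ρ) hx)))
    (λ ρ n → ¬∨-intro (¬∨-elimˡ n) (↝-contra ρ (¬∨-elimʳ n)))

  isCHA : IsCHA _∧_ _∨_ _↝_ 𝟎 𝟏
  isCHA = record
    { isBDL = isBDL
    ; C1    = ↝-C1
    ; C2    = ↝-C2
    ; C3    = ↝-C3
    ; C4    = λ x y z → sym (↝-C4 x y z)
    ; C5    = λ x y z → sym (↝-C5 x y z)
    }

  H⇒-C↝ : ∀ x y → H⇒ _∧_ _↝_ x y ≡ x ⇒ y
  H⇒-C↝ x y = ≤-antisym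
    (⇒-intro λ ρ hx → ∧-elimʳ (↝-elim ρ hx))
    (↝-intro (λ ρ hx → ∧-greatest hx (⇒-elim ρ hx))
             (λ _ nx → ¬-intro λ ρ h → ¬-elim (wk ρ nx) (∧-elimˡ h)))

module ConnexiveToHeyting {a : Level} {A : Set a} {_∧_ _∨_ _↝_ : Op₂ A} {𝟎 𝟏 : A}
                          (isCHA : IsCHA _∧_ _∨_ _↝_ 𝟎 𝟏) where
  open IsCHA isCHA using (isBDL; C1; C2; C3; C4; C5)
  open BoundedLatticeOrder isBDL
  open ≡-Reasoning

  _⇒_ : Op₂ A
  _⇒_ = H⇒ _∧_ _↝_

  private variable
    Γ x y z : A

  𝟏↝ : ∀ x → 𝟏 ↝ x ≡ x
  𝟏↝ x = begin
    𝟏 ↝ x         ≡⟨ ∧-identityˡ (𝟏 ↝ x) ⟨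
    𝟏 ∧ (𝟏 ↝ x)   ≡⟨ C3 𝟏 x ⟩
    𝟏 ∧ x         ≡⟨ ∧-identityˡ x ⟩
    x             ∎

  ↝-mp : Γ ≤ x → Γ ≤ x ↝ y → Γ ≤ y
  ↝-mp {x = x} {y} hx f = ≤-trans (∧-greatest hx f) (≤-trans (reflexive (C3 x y)) (x∧y≤y x y))

  𝟏≤↝⇒≤ : 𝟏 ≤ x ↝ y → x ≤ y
  𝟏≤↝⇒≤ h = ↝-mp ≤-refl (≤-trans (maximum _) h)

  ↝≡𝟏⇒≤ : x ↝ y ≡ 𝟏 → x ≤ y
  ↝≡𝟏⇒≤ e = 𝟏≤↝⇒≤ (reflexive (sym e))

  ↝-precomp : Γ ≤ x ↝ y → Γ ≤ (y ↝ z) ↝ (x ↝ z)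
  ↝-precomp f = ↝-mp f (≤-trans (maximum _) (reflexive (sym (C1 _ _ _))))

  ↝-trans : Γ ≤ x ↝ y → Γ ≤ y ↝ z → Γ ≤ x ↝ z
  ↝-trans f g = ↝-mp g (↝-precomp f)

  ↝-∧ˡ : x ↝ y ≤ (z ∧ x) ↝ (z ∧ y)
  ↝-∧ˡ = sym (C4 _ _ _)

  ↝-∨ˡ : x ↝ y ≤ (z ∨ x) ↝ (z ∨ y)
  ↝-∨ˡ = sym (C5 _ _ _)

  ≤↝𝟏 : x ≤ x ↝ 𝟏
  ≤↝𝟏 {x} = sym (trans (C3 x 𝟏) (∧-identityʳ x))

  ≤↝∧ : y ≤ x ↝ (x ∧ y)
  ≤↝∧ {y} {x} = ≤-trans (reflexive (sym (𝟏↝ y)))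
    (subst (λ t → 𝟏 ↝ y ≤ t ↝ (x ∧ y)) (∧-identityʳ x) ↝-∧ˡ)

  ↝-monoʳ : y ≤ z → z ≤ x → x ↝ y ≤ x ↝ z
  ↝-monoʳ {y} {z} {x} y≤z z≤x = subst₂ (λ s t → x ↝ y ≤ s ↝ t)
    (x≤y⇒x∨y≈y z≤x) (trans (∨-comm z y) (x≤y⇒x∨y≈y y≤z)) ↝-∨ˡ

  isHA : IsHA _∧_ _∨_ _⇒_ 𝟎 𝟏
  isHA = record
    { isBDL          = isBDL
    ; relPseudoCompl = λ x y z →
        mk⇔ (λ p → sym (transpose-∧ x y z (sym p))) (λ q → sym (transpose-⇒ x y z (sym q)))
    }
    where
    transpose-∧ : ∀ x y z → z ≤ x ⇒ y → z ∧ x ≤ y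
    transpose-∧ x y z p = ≤-trans (↝-mp (x∧y≤y z x) (≤-trans (x∧y≤x z x) p)) (x∧y≤y x y)
    transpose-⇒ : ∀ x y z → z ∧ x ≤ y → z ≤ x ⇒ y
    transpose-⇒ x y z q = ≤-trans ≤↝∧
      (↝-monoʳ (∧-greatest (x∧y≤x x z) (≤-trans (reflexive (∧-comm x z)) q)) (x∧y≤x x y))

  open HeytingSequents isHA using (¬_; wk; ⇒-intro; ¬-intro; ¬⇒¬≤¬¬⇒)

  ¬≡↝𝟎 : ∀ x → ¬ x ≡ x ↝ 𝟎
  ¬≡↝𝟎 x = cong (x ↝_) (∧-zeroʳ x)

  ↝≤⇒ : x ↝ y ≤ x ⇒ y
  ↝≤⇒ {x} {y} = subst (λ t → x ↝ y ≤ t ↝ (x ∧ y)) (∧-idem x) ↝-∧ˡ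

  ≤𝟎↝¬ : y ≤ 𝟎 ↝ (y ↝ 𝟎)
  ≤𝟎↝¬ {y} = ≤-trans ≤↝𝟏 (subst₂ (λ s t → y ↝ 𝟏 ≤ s ↝ t) y↝𝟎∧y≡𝟎 (∧-identityʳ (y ↝ 𝟎)) ↝-∧ˡ)
    where
    y↝𝟎∧y≡𝟎 : (y ↝ 𝟎) ∧ y ≡ 𝟎
    y↝𝟎∧y≡𝟎 = begin
      (y ↝ 𝟎) ∧ y   ≡⟨ ∧-comm (y ↝ 𝟎) y ⟩
      y ∧ (y ↝ 𝟎)   ≡⟨ C3 y 𝟎 ⟩
      y ∧ 𝟎         ≡⟨ ∧-zeroʳ y ⟩
      𝟎             ∎

  ↝≤¬⇒¬ : x ↝ y ≤ ¬ x ⇒ ¬ y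
  -- ¬ x and y chain through 𝟎 to x ↝ ¬ y, which (C2) refutes in the presence of x ↝ y.
  ↝≤¬⇒¬ {x} {y} = ⇒-intro λ ρ nx → ¬-intro λ ρ′ hy →
    ↝-mp (↝-trans (wk ρ′ (≤-trans nx (reflexive (¬≡↝𝟎 x)))) (≤-trans hy ≤𝟎↝¬))
         (wk ρ′ (≤-trans ρ (↝≡𝟏⇒≤ (C2 x y))))

  ¬¬≤↝𝟏 : ¬ ¬ x ≤ x ↝ 𝟏
  ¬¬≤↝𝟏 {x} = ≤-trans (reflexive ¬¬≡) (≤-trans ≤↝𝟏 (𝟏≤↝⇒≤ (↝-precomp (reflexive (sym x↝¬¬x≡𝟏)))))
    where
    ¬¬≡ : ¬ ¬ x ≡ (x ↝ 𝟎) ↝ 𝟎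
    ¬¬≡ = trans (¬≡↝𝟎 (¬ x)) (cong (_↝ 𝟎) (¬≡↝𝟎 x))
    x↝¬¬x≡𝟏 : x ↝ ((x ↝ 𝟎) ↝ 𝟎) ≡ 𝟏
    x↝¬¬x≡𝟏 = subst₂ (λ s t → s ↝ ((x ↝ 𝟎) ↝ t) ≡ 𝟏) (𝟏↝ x) (𝟏↝ 𝟎) (C1 𝟏 x 𝟎)

  ⇒↝𝟏≤∧↝ : (y ⇒ x) ↝ 𝟏 ≤ (x ∧ y) ↝ y
  ⇒↝𝟏≤∧↝ {y} {x} = subst₂ (λ s t → (y ⇒ x) ↝ 𝟏 ≤ s ↝ t) y∧[y⇒x]≡x∧y (∧-identityʳ y) ↝-∧ˡ
    where
    y∧[y⇒x]≡x∧y : y ∧ (y ⇒ x) ≡ x ∧ y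
    y∧[y⇒x]≡x∧y = begin
      y ∧ (y ↝ (y ∧ x)) ≡⟨ C3 y (y ∧ x) ⟩
      y ∧ (y ∧ x)       ≡⟨ ∧-assoc y y x ⟨
      (y ∧ y) ∧ x       ≡⟨ cong (_∧ x) (∧-idem y) ⟩
      y ∧ x             ≡⟨ ∧-comm y x ⟩
      x ∧ y             ∎

  C↝≤↝ : C↝ _∧_ 𝟎 _⇒_ x y ≤ x ↝ y
  C↝≤↝ {x} {y} = ↝-trans (x∧y≤x _ _)
    (≤-trans (x∧y≤y _ _) (≤-trans (¬⇒¬≤¬¬⇒ x y) (≤-trans ¬¬≤↝𝟏 ⇒↝𝟏≤∧↝)))

  C↝-H⇒ : ∀ x y → C↝ _∧_ 𝟎 _⇒_ x y ≡ x ↝ y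
  C↝-H⇒ x y = ≤-antisym C↝≤↝ (∧-greatest ↝≤⇒ ↝≤¬⇒¬)

theorem3p15 : ∀ {a : Level} {A : Set a} (_∧_ _∨_ : Op₂ A) (𝟎 𝟏 : A)
    → ((_↝_ : Op₂ A) → IsCHA _∧_ _∨_ _↝_ 𝟎 𝟏
        → IsHA _∧_ _∨_ (H⇒ _∧_ _↝_) 𝟎 𝟏
          × (∀ x y → C↝ _∧_ 𝟎 (H⇒ _∧_ _↝_) x y ≡ (x ↝ y)))
    × ((_⇒_ : Op₂ A) → IsHA _∧_ _∨_ _⇒_ 𝟎 𝟏
        → IsCHA _∧_ _∨_ (C↝ _∧_ 𝟎 _⇒_) 𝟎 𝟏
          × (∀ x y → H⇒ _∧_ (C↝ _∧_ 𝟎 _⇒_) x y ≡ (x ⇒ y)))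
theorem3p15 _ _ _ _ =
    (λ _ isCHA → ConnexiveToHeyting.isHA isCHA , ConnexiveToHeyting.C↝-H⇒ isCHA)
  , (λ _ isHA → HeytingToConnexive.isCHA isHA , HeytingToConnexive.H⇒-C↝ isHA)
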